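{- For every positive integer $k$ there exists a positive integer $n$ such that $k \in R(n,1)$.
   Context: A complementary alphabet of size $m$ is a set consisting of $m$ pairs of complementary letters $\{A,\bar{A},B,\bar{B},\ldots\}$; $\bar{A}$ is the complement of $A$ and $A$ is the complement of $\bar{A}$. (So for $m=1$ the alphabet is $\{A,\bar{A}\}$.) Let $T$ be a rooted plane tree with $n$ edges and $P=p_1p_2\ldots p_{2n}$ a word over a complementary alphabet. Label the edges of $T$ by the letters of $P$ in order along a counter-clockwise walk around the boundary of $T$ starting at the root, so that every edge receives two letters (one when the walk traverses it going down, one going up). $T$ is called $P$-valid if every edge receives a pair of complementary letters. Let $V(P)$ denote the set of $P$-valid rooted plane trees with $n$ edges. Let $\mathcal{P}(n,m)$ be the set of words $P$ of length $2n$ over a complementary alphabet of size $m$ having at least one $P$-valid plane tree, and let $R(n,m)$ be the set of positive integers $k$ such that there exists $P\in\mathcal{P}(n,m)$ with $|V(P)|=k$. -}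

module Defs where

open import Data.Nat using (ℕ; zero; suc; _+_; _*_; _≤_)
open import Data.Unit using (⊤)
open import Data.Bool using (Bool; true; false; not)
open import Data.List using (List; []; _∷_; _++_; length)
open import Data.List.Membership.Propositional using (_∈_)
open import Data.List.Relation.Unary.Unique.Propositional using (Unique)
open import Data.Vec using (Vec; toList)
open import Data.Product using (Σ; _×_; _,_; ∃)
open import Function.Bundles using (_⇔_)
open import Relation.Binary.PropositionalEquality using (_≡_)

-- Complementary alphabet of size m = 1: {A, Ā}, encoded as Bool
-- (true = A, false = Ā); the complement of a letter is `not`.
Letter₁ : Set
Letter₁ = Bool

complement : Letter₁ → Letter₁
complement = not

-- Rooted plane trees: a node with an ordered list of subtrees
-- (each subtree hangs from the node by one edge).
data Tree : Set where
  node : List Tree → Tree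

mutual
  edges : Tree → ℕ
  edges (node ts) = edgesF ts

  edgesF : List Tree → ℕ
  edgesF [] = 0
  edgesF (t ∷ ts) = suc (edges t) + edgesF ts

-- Edge-labelled rooted plane trees: every edge carries the letter
-- read when the walk goes down it and the letter read when it goes up.
data LTree : Set where
  lnode : List (Letter₁ × Letter₁ × LTree) → LTree

mutual
  shape : LTree → Tree
  shape (lnode cs) = node (shapeF cs)

  shapeF : List (Letter₁ × Letter₁ × LTree) → List Tree
  shapeF [] = []
  shapeF ((d , u , t) ∷ cs) = shape t ∷ shapeF cs

  -- word read along the boundary walk starting at the root
  contour : LTree → List Letter₁
  contour (lnode cs) = contourF cs

  contourF : List (Letter₁ × Letter₁ × LTree) → List Letter₁
  contourF [] = []
  contourF ((d , u , t) ∷ cs) = (d ∷ contour t ++ (u ∷ [])) ++ contourF cs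

  Complementary : LTree → Set
  Complementary (lnode cs) = ComplementaryF cs

  ComplementaryF : List (Letter₁ × Letter₁ × LTree) → Set
  ComplementaryF [] = ⊤
  ComplementaryF ((d , u , t) ∷ cs) = (u ≡ complement d) × Complementary t × ComplementaryF cs

-- T is P-valid: labelling the edges of T by the letters of P in order
-- along the walk gives every edge a complementary pair.
Valid : Tree → List Letter₁ → Set
Valid T P = Σ LTree λ L → shape L ≡ T × contour L ≡ P × Complementary L

InV : (n : ℕ) → Vec Letter₁ (2 * n) → Tree → Set
InV n P T = edges T ≡ n × Valid T (toList P)

-- |V(P)| = k : V(P) is enumerated by a duplicate-free list of length k
HasCard : (Tree → Set) → ℕ → Set
HasCard S k = Σ (List Tree) λ xs → Unique xs × length xs ≡ k × (∀ T → (S T ⇔ (T ∈ xs)))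

InCalP₁ : (n : ℕ) → Vec Letter₁ (2 * n) → Set
InCalP₁ n P = ∃ λ T → InV n P T

InR₁ : ℕ → ℕ → Set
InR₁ n k = 1 ≤ k × Σ (Vec Letter₁ (2 * n)) λ P → InCalP₁ n P × HasCard (InV n P) k

module Submission where

-- For k = p + 1 we take q = p + 1 and the word  G p q = A^p Ā^q A^q Ā^p.
-- A valid labelled tree is a forest whose contour is the word and whose
-- every edge reads a letter going down and its complement going up.  Its
-- first edge opens with the first A; it closes either
--   * inside the block Ā^q, necessarily at its (p+1)-st letter because the
--     subtree below it has a balanced contour; the rest of the forest is then
--     forced to be two chains (`closing-case`), or
--   * at the very last letter, and then the tree is the outermost edge over a
--     valid tree of  G (p-1) q  (`wrapping-case`).

open import Defs
open import Data.Nat using (ℕ; zero; suc; _+_; _*_; _∸_; _≤_)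
open import Data.Nat.Properties
  using (+-suc; +-comm; +-assoc; +-identityʳ; +-cancelˡ-≡; *-cancelˡ-≡;
         suc-injective; m+n∸n≡m; m∸n+n≡m; m≤n+m; ≤-trans; n≤1+n; m≢1+m+n)
open import Data.Nat.Tactic.RingSolver using (solve-∀)
open import Data.Bool using (true; false; not)
open import Data.Bool.Properties using (not-¬)
open import Data.Unit using (tt)
open import Data.Empty using (⊥-elim)
open import Data.Product using (Σ; _×_; _,_; ∃)
open import Data.Sum using (_⊎_; inj₁; inj₂)
import Data.Sum as Sum
open import Data.List using (List; []; _∷_; _++_; [_]; length; map; replicate)
open import Data.List.Properties
  using (∷-injective; ∷-injectiveˡ; ∷-injectiveʳ; ++-assoc; ++-identityʳ;
         ++-conicalʳ; length-++; length-map; length-replicate; ++-monoid)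
open import Data.List.Membership.Propositional using (_∈_)
open import Data.List.Membership.Propositional.Properties using (∈-map⁺; ∈-map⁻)
open import Data.List.Relation.Unary.Any using (here; there)
import Data.List.Relation.Unary.All as All
open import Data.List.Relation.Unary.All.Properties using (map⁺)
open import Data.List.Relation.Unary.Unique.Propositional using (Unique)
open import Data.List.Relation.Unary.AllPairs using ([]; _∷_)
import Data.List.Relation.Unary.Unique.Propositional.Properties as Unique
open import Data.Vec using (Vec; toList; fromList; cast)
open import Data.Vec.Properties using (toList-cast; toList∘fromList)
open import Function using (_∘_)
open import Function.Bundles using (_⇔_; mk⇔; Equivalence)
open import Relation.Binary.PropositionalEquality
  using (_≡_; _≢_; refl; sym; trans; cong; cong₂; subst)
open import Algebra.Solver.Monoid (++-monoid Letter₁) using (solve; _⊕_; _⊜_)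
open Relation.Binary.PropositionalEquality.≡-Reasoning

A Ā : Letter₁
A = true
Ā = false

Word : Set
Word = List Letter₁

Forest : Set
Forest = List (Letter₁ × Letter₁ × LTree)

+-suc-comm : ∀ m n → m + suc n ≡ n + suc m
+-suc-comm m n = trans (+-suc m n) (trans (cong suc (+-comm m n)) (sym (+-suc n m)))

no-room : ∀ m j → suc m ≡ m + suc j → j ≡ 0
no-room m j eq = suc-injective (+-cancelˡ-≡ m (suc j) 1 (trans (sym eq) (+-comm 1 m)))

double-count : ∀ e f → suc (2 * e + suc (2 * f)) ≡ 2 * (suc e + f)
double-count = solve-∀

four-blocks : ∀ p q → p + (q + (q + p)) ≡ 2 * (p + q)
four-blocks = solve-∀

replicate-+ : ∀ m n (x : Letter₁) → replicate (m + n) x ≡ replicate m x ++ replicate n x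
replicate-+ zero    n x = refl
replicate-+ (suc m) n x = cong (x ∷_) (replicate-+ m n x)

replicate-snoc : ∀ n (x : Letter₁) → replicate n x ++ [ x ] ≡ x ∷ replicate n x
replicate-snoc zero    x = refl
replicate-snoc (suc n) x = cong (x ∷_) (replicate-snoc n x)

same : Letter₁ → Letter₁ → ℕ
same true  true  = 1
same true  false = 0
same false true  = 0
same false false = 1

occ : Letter₁ → Word → ℕ
occ c []       = 0
occ c (x ∷ xs) = same c x + occ c xs

occ-++ : ∀ c xs ys → occ c (xs ++ ys) ≡ occ c xs + occ c ys
occ-++ c []       ys = refl
occ-++ c (x ∷ xs) ys = trans (cong (same c x +_) (occ-++ c xs ys)) (sym (+-assoc (same c x) _ _))

occ-replicate-self : ∀ c n → occ c (replicate n c) ≡ n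
occ-replicate-self true  zero    = refl
occ-replicate-self true  (suc n) = cong suc (occ-replicate-self true n)
occ-replicate-self false zero    = refl
occ-replicate-self false (suc n) = cong suc (occ-replicate-self false n)

occ-replicate-other : ∀ {c d} → c ≢ d → ∀ n → occ c (replicate n d) ≡ 0
occ-replicate-other {c} {d} c≢d zero    = refl
occ-replicate-other {c} {d} c≢d (suc n) = trans (cong (_+ occ c (replicate n d)) (same-≢ c d c≢d)) (occ-replicate-other c≢d n)
  where
    same-≢ : ∀ c d → c ≢ d → same c d ≡ 0
    same-≢ true  true  ne = ⊥-elim (ne refl)
    same-≢ true  false _  = refl
    same-≢ false true  _  = refl
    same-≢ false false ne = ⊥-elim (ne refl)

occ-edge : ∀ c d X Y → occ c (d ∷ X ++ not d ∷ Y) ≡ suc (occ c X + occ c Y)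
occ-edge c d X Y = trans (cong (same c d +_) (occ-++ c X (not d ∷ Y))) (one-each c d)
  where
    one-each : ∀ c d → same c d + (occ c X + (same c (not d) + occ c Y)) ≡ suc (occ c X + occ c Y)
    one-each true  true  = refl
    one-each true  false = +-suc (occ true X) (occ true Y)
    one-each false true  = +-suc (occ false X) (occ false Y)
    one-each false false = refl

occ-blocks : ∀ c w₁ w₂ w₃ w₄ → occ c (w₁ ++ w₂ ++ w₃ ++ w₄) ≡ occ c w₁ + (occ c w₂ + (occ c w₃ + occ c w₄))
occ-blocks c w₁ w₂ w₃ w₄ =
  trans (occ-++ c w₁ _) (cong (occ c w₁ +_) (trans (occ-++ c w₂ _) (cong (occ c w₂ +_) (occ-++ c w₃ w₄))))

Balanced : Word → Set
Balanced w = occ A w ≡ occ Ā w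

balanced-flip : ∀ d {w} → Balanced w → occ d w ≡ occ (not d) w
balanced-flip true  bal = bal
balanced-flip false bal = sym bal

balanced-blocks : ∀ d m l i → Balanced (replicate m d ++ replicate l (not d) ++ replicate l d ++ replicate i (not d)) → i ≡ m
balanced-blocks d m l i bal = +-cancelˡ-≡ l i m (begin
    l + i                  ≡⟨ sym count-d̄ ⟩
    occ (not d) w          ≡⟨ sym (balanced-flip d {w} bal) ⟩
    occ d w                ≡⟨ count-d ⟩
    m + l                  ≡⟨ +-comm m l ⟩
    l + m                  ∎)
  where
    w : Word
    w = replicate m d ++ replicate l (not d) ++ replicate l d ++ replicate i (not d)
    d≢d̄ : d ≢ not d
    d≢d̄ = not-¬ refl
    count-d : occ d w ≡ m + l
    count-d rewrite occ-blocks d (replicate m d) (replicate l (not d)) (replicate l d) (replicate i (not d))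
                  | occ-replicate-self d m | occ-replicate-other d≢d̄ l
                  | occ-replicate-self d l | occ-replicate-other d≢d̄ i
                  | +-identityʳ l = refl
    count-d̄ : occ (not d) w ≡ l + i
    count-d̄ rewrite occ-blocks (not d) (replicate m d) (replicate l (not d)) (replicate l d) (replicate i (not d))
                  | occ-replicate-other (d≢d̄ ∘ sym) m | occ-replicate-self (not d) l
                  | occ-replicate-other (d≢d̄ ∘ sym) l | occ-replicate-self (not d) i = refl


contour-cons : ∀ d u t cs → contourF ((d , u , t) ∷ cs) ≡ d ∷ contour t ++ u ∷ contourF cs
contour-cons d u t cs = cong (d ∷_) (++-assoc (contour t) [ u ] (contourF cs))

contour-++ : ∀ F G → contourF (F ++ G) ≡ contourF F ++ contourF G
contour-++ []              G = refl
contour-++ ((d , u , t) ∷ F) G =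
  trans (cong ((d ∷ contour t ++ [ u ]) ++_) (contour-++ F G))
        (sym (++-assoc (d ∷ contour t ++ [ u ]) (contourF F) (contourF G)))

contour-empty : ∀ F → contourF F ≡ [] → F ≡ []
contour-empty []      _ = refl
contour-empty (_ ∷ _) ()

complementary-++ : ∀ F G → ComplementaryF F → ComplementaryF G → ComplementaryF (F ++ G)
complementary-++ []                G _              cG = cG
complementary-++ ((d , u , t) ∷ F) G (cu , ct , cF) cG = cu , ct , complementary-++ F G cF cG

contour-balanced : ∀ F → ComplementaryF F → Balanced (contourF F)
contour-balanced []                            _                 = refl
contour-balanced ((d , .(not d) , lnode ts) ∷ cs) (refl , cts , ccs) = begin
  occ A (contourF ((d , not d , lnode ts) ∷ cs))       ≡⟨ cong (occ A) (contour-cons d (not d) (lnode ts) cs) ⟩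
  occ A (d ∷ contourF ts ++ not d ∷ contourF cs)       ≡⟨ occ-edge A d (contourF ts) (contourF cs) ⟩
  suc (occ A (contourF ts) + occ A (contourF cs))      ≡⟨ cong₂ (λ x y → suc (x + y)) (contour-balanced ts cts) (contour-balanced cs ccs) ⟩
  suc (occ Ā (contourF ts) + occ Ā (contourF cs))      ≡⟨ sym (occ-edge Ā d (contourF ts) (contourF cs)) ⟩
  occ Ā (d ∷ contourF ts ++ not d ∷ contourF cs)       ≡⟨ cong (occ Ā) (sym (contour-cons d (not d) (lnode ts) cs)) ⟩
  occ Ā (contourF ((d , not d , lnode ts) ∷ cs))       ∎

-- The contour walks along every edge twice.
contour-length : ∀ F → length (contourF F) ≡ 2 * edgesF (shapeF F)
contour-length []                         = refl
contour-length ((d , u , lnode ts) ∷ cs) = begin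
  length (contourF ((d , u , lnode ts) ∷ cs))            ≡⟨ cong length (contour-cons d u (lnode ts) cs) ⟩
  suc (length (contourF ts ++ u ∷ contourF cs))          ≡⟨ cong suc (length-++ (contourF ts)) ⟩
  suc (length (contourF ts) + suc (length (contourF cs))) ≡⟨ cong₂ (λ x y → suc (x + suc y)) (contour-length ts) (contour-length cs) ⟩
  suc (2 * e + suc (2 * f))                              ≡⟨ double-count e f ⟩
  2 * (suc e + f)                                        ∎
  where
    e f : ℕ
    e = edgesF (shapeF ts)
    f = edgesF (shapeF cs)

valid-edges : ∀ T w → Valid T w → 2 * edges T ≡ length w
valid-edges _ _ (lnode F , refl , refl , _) = sym (contour-length F)

split-block : ∀ {c d : Letter₁} → d ≢ c → ∀ m l X Y W → X ++ c ∷ Y ≡ replicate m d ++ replicate l c ++ W →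
  (Σ ℕ λ i → Σ ℕ λ j → l ≡ i + suc j × X ≡ replicate m d ++ replicate i c × Y ≡ replicate j c ++ W)
  ⊎ (Σ Word λ X′ → X ≡ replicate m d ++ replicate l c ++ X′ × X′ ++ c ∷ Y ≡ W)
split-block d≢c (suc m) l []      Y W eq = ⊥-elim (d≢c (sym (∷-injectiveˡ eq)))
split-block d≢c (suc m) l (x ∷ X) Y W eq with ∷-injective eq
... | refl , eq′ = Sum.map (λ (i , j , l≡ , X≡ , Y≡) → i , j , l≡ , cong (x ∷_) X≡ , Y≡)
                           (λ (X′ , X≡ , rest) → X′ , cong (x ∷_) X≡ , rest)
                           (split-block d≢c m l X Y W eq′)
split-block d≢c zero zero    X       Y W eq = inj₂ (X , refl , eq)
split-block d≢c zero (suc l) []      Y W eq = inj₁ (0 , l , refl , refl , ∷-injectiveʳ eq)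
split-block d≢c zero (suc l) (x ∷ X) Y W eq with ∷-injective eq
... | refl , eq′ = Sum.map (λ (i , j , l≡ , X≡ , Y≡) → suc i , j , cong suc l≡ , cong (x ∷_) X≡ , Y≡)
                           (λ (X′ , X≡ , rest) → X′ , cong (x ∷_) X≡ , rest)
                           (split-block d≢c zero l X Y W eq′)

absent : ∀ {c d : Letter₁} → d ≢ c → ∀ n X Y → X ++ c ∷ Y ≢ replicate n d
absent d≢c zero    []      Y ()
absent d≢c zero    (x ∷ X) Y ()
absent d≢c (suc n) []      Y eq = d≢c (sym (∷-injectiveˡ eq))
absent d≢c (suc n) (x ∷ X) Y eq = absent d≢c n X Y (∷-injectiveʳ eq)

nonempty : ∀ X (c : Letter₁) Y → X ++ c ∷ Y ≢ []
nonempty X c Y eq with ++-conicalʳ X (c ∷ Y) eq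
... | ()

-- How the first edge of a valid forest with contour d^(m+1) d̄^l W closes:
-- inside the block d̄^l (then its subtree is the chain contour d^m d̄^m,
-- by balance), or after the whole block.
data FirstEdge (d : Letter₁) (m l : ℕ) (W : Word) : Forest → Set where
  inside : ∀ {ts cs} j → l ≡ m + suc j → ComplementaryF ts → ComplementaryF cs →
           contourF ts ≡ replicate m d ++ replicate m (not d) →
           contourF cs ≡ replicate j (not d) ++ W →
           FirstEdge d m l W ((d , not d , lnode ts) ∷ cs)
  beyond : ∀ {ts cs} X → ComplementaryF ts → ComplementaryF cs →
           contourF ts ≡ replicate m d ++ replicate l (not d) ++ X →
           X ++ not d ∷ contourF cs ≡ W →
           FirstEdge d m l W ((d , not d , lnode ts) ∷ cs)

first-edge : ∀ {d m l W} F → ComplementaryF F →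
             contourF F ≡ d ∷ replicate m d ++ replicate l (not d) ++ W → FirstEdge d m l W F
first-edge [] _ ()
first-edge {d} {m} {l} {W} ((e , .(not e) , lnode ts) ∷ cs) (refl , cts , ccs) eq
  with ∷-injective (trans (sym (contour-cons e (not e) (lnode ts) cs)) eq)
... | refl , eq′ with split-block (not-¬ refl) m l (contourF ts) (contourF cs) W eq′
... | inj₂ (X , ts≡ , rest) = beyond X cts ccs ts≡ rest
... | inj₁ (i , j , l≡ , ts≡ , cs≡)
  with balanced-blocks d m 0 i (subst Balanced ts≡ (contour-balanced ts cts))
... | refl = inside j l≡ cts ccs ts≡ cs≡

chain : Letter₁ → ℕ → Forest
chain d zero    = []
chain d (suc x) = (d , not d , lnode (chain d x)) ∷ []

chain-complementary : ∀ d x → ComplementaryF (chain d x)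
chain-complementary d zero    = tt
chain-complementary d (suc x) = refl , chain-complementary d x , tt

chain-contour : ∀ d x → contourF (chain d x) ≡ replicate x d ++ replicate x (not d)
chain-contour d zero    = refl
chain-contour d (suc x) = begin
  contourF (chain d (suc x))                            ≡⟨ contour-cons d (not d) (lnode (chain d x)) [] ⟩
  d ∷ contourF (chain d x) ++ [ not d ]                 ≡⟨ cong (λ w → d ∷ w ++ [ not d ]) (chain-contour d x) ⟩
  d ∷ (replicate x d ++ replicate x (not d)) ++ [ not d ] ≡⟨ cong (d ∷_) (++-assoc (replicate x d) _ _) ⟩
  d ∷ replicate x d ++ replicate x (not d) ++ [ not d ]  ≡⟨ cong (λ w → d ∷ replicate x d ++ w) (replicate-snoc x (not d)) ⟩
  replicate (suc x) d ++ replicate (suc x) (not d)       ∎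

chain-unique : ∀ d x F → ComplementaryF F → contourF F ≡ replicate x d ++ replicate x (not d) → F ≡ chain d x
chain-unique d zero    F cF eq = contour-empty F eq
chain-unique d (suc x) F cF eq
  with first-edge {d} {x} {suc x} {[]} F cF (trans eq (cong (λ w → d ∷ replicate x d ++ w) (sym (++-identityʳ _))))
... | beyond X _ _ _ rest = ⊥-elim (nonempty X (not d) _ rest)
... | inside {ts} {cs} j l≡ cts ccs ts≡ cs≡ with no-room x j l≡
... | refl = cong₂ (λ t c → (d , not d , lnode t) ∷ c) (chain-unique d x ts cts ts≡) (contour-empty cs cs≡)

two-chains-unique : ∀ r p F → ComplementaryF F →
  contourF F ≡ replicate r Ā ++ replicate r A ++ replicate p A ++ replicate p Ā → F ≡ chain Ā r ++ chain A p
two-chains-unique zero    p F cF eq = chain-unique A p F cF eq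
two-chains-unique (suc r) p F cF eq with first-edge {Ā} {r} {suc r} F cF eq
... | inside {ts} {cs} j l≡ cts ccs ts≡ cs≡ with no-room r j l≡
... | refl = cong₂ (λ t c → (Ā , A , lnode t) ∷ c) (chain-unique Ā r ts cts ts≡) (chain-unique A p cs ccs cs≡)
-- Closing beyond A^(r+1) would leave the subtree the contour Ā^r A^(r+1+i).
two-chains-unique (suc r) p F cF eq | beyond {ts} {cs} X cts _ ts≡ rest
  with split-block {A} {Ā} (λ ()) 0 p X (contourF cs) (replicate p Ā) rest
... | inj₂ (X′ , _ , rest′) = ⊥-elim (absent {A} {Ā} (λ ()) p X′ (contourF cs) rest′)
... | inj₁ (i , _ , _ , refl , _) = ⊥-elim (m≢1+m+n r (sym (balanced-blocks Ā r 0 (suc r + i) ts-balanced)))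
  where
    ts-balanced : Balanced (replicate r Ā ++ replicate (suc r + i) A)
    ts-balanced = subst Balanced (trans ts≡ (cong (replicate r Ā ++_) (sym (replicate-+ (suc r) i A))))
                                (contour-balanced ts cts)

G : ℕ → ℕ → Word
G p q = replicate p A ++ replicate q Ā ++ replicate q A ++ replicate p Ā

G-length : ∀ p q → length (G p q) ≡ 2 * (p + q)
G-length p q = begin
  length (G p q)
    ≡⟨ trans (length-++ (replicate p A)) (cong (length (replicate p A) +_) (trans (length-++ (replicate q Ā))
         (cong (length (replicate q Ā) +_) (length-++ (replicate q A))))) ⟩
  length (replicate p A) + (length (replicate q Ā) + (length (replicate q A) + length (replicate p Ā)))
    ≡⟨ cong₂ _+_ (length-replicate p) (cong₂ _+_ (length-replicate q) (cong₂ _+_ (length-replicate q) (length-replicate p))) ⟩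
  p + (q + (q + p))
    ≡⟨ four-blocks p q ⟩
  2 * (p + q) ∎

-- The valid forest of G (p+1) (p+1+j) whose first edge closes inside Ā^q.
closing : ℕ → ℕ → Forest
closing p j = (A , Ā , lnode (chain A p)) ∷ (chain Ā j ++ chain A (suc p))

wrap : Tree → Tree
wrap T = node (T ∷ [])

-- The list of P-valid trees of P = G p q (for p ≤ q).
trees : ℕ → ℕ → List Tree
trees zero    q = node (shapeF (chain Ā q)) ∷ []
trees (suc p) q = node (shapeF (closing p (q ∸ suc p))) ∷ map wrap (trees p q)

closing-contour : ∀ p j → contourF (closing p j) ≡ G (suc p) (j + suc p)
closing-contour p j = begin
  contourF (closing p j)
    ≡⟨ contour-cons A Ā (lnode (chain A p)) (chain Ā j ++ chain A (suc p)) ⟩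
  A ∷ contourF (chain A p) ++ Ā ∷ contourF (chain Ā j ++ chain A (suc p))
    ≡⟨ cong₂ (λ u v → A ∷ u ++ Ā ∷ v) (chain-contour A p)
             (trans (contour-++ (chain Ā j) _) (cong₂ _++_ (chain-contour Ā j) (chain-contour A (suc p)))) ⟩
  A ∷ (Pa ++ PĀ) ++ [ Ā ] ++ (JĀ ++ Ja) ++ (Sa ++ SĀ)
    ≡⟨ cong (A ∷_) (solve 7 (λ x₁ x₂ x₃ x₄ x₅ x₆ x₇ →
          (x₁ ⊕ x₂) ⊕ x₃ ⊕ (x₄ ⊕ x₅) ⊕ (x₆ ⊕ x₇) ⊜ x₁ ⊕ (x₂ ⊕ x₃ ⊕ x₄) ⊕ (x₅ ⊕ x₆) ⊕ x₇) refl Pa PĀ [ Ā ] JĀ Ja Sa SĀ) ⟩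
  A ∷ Pa ++ (PĀ ++ Ā ∷ JĀ) ++ (Ja ++ Sa) ++ SĀ
    ≡⟨ cong₂ (λ u v → A ∷ Pa ++ u ++ v ++ SĀ)
             (trans (sym (replicate-+ p (suc j) Ā)) (cong (λ k → replicate k Ā) (+-suc-comm p j)))
             (sym (replicate-+ j (suc p) A)) ⟩
  G (suc p) (j + suc p) ∎
  where
    Pa PĀ JĀ Ja Sa SĀ : Word
    Pa = replicate p A
    PĀ = replicate p Ā
    JĀ = replicate j Ā
    Ja = replicate j A
    Sa = replicate (suc p) A
    SĀ = replicate (suc p) Ā

wrap-contour : ∀ p q F → contourF F ≡ G p q → contourF ((A , Ā , lnode F) ∷ []) ≡ G (suc p) q
wrap-contour p q F eq = begin
  contourF ((A , Ā , lnode F) ∷ [])          ≡⟨ contour-cons A Ā (lnode F) [] ⟩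
  A ∷ contourF F ++ [ Ā ]                    ≡⟨ cong (λ w → A ∷ w ++ [ Ā ]) eq ⟩
  A ∷ G p q ++ [ Ā ]
    ≡⟨ cong (A ∷_) (solve 5 (λ a b c d e → (a ⊕ b ⊕ c ⊕ d) ⊕ e ⊜ a ⊕ b ⊕ c ⊕ d ⊕ e) refl
                      (replicate p A) (replicate q Ā) (replicate q A) (replicate p Ā) [ Ā ]) ⟩
  A ∷ replicate p A ++ replicate q Ā ++ replicate q A ++ replicate p Ā ++ [ Ā ]
    ≡⟨ cong (λ w → A ∷ replicate p A ++ replicate q Ā ++ replicate q A ++ w) (replicate-snoc p Ā) ⟩
  G (suc p) q ∎

trees-sound : ∀ p q T → p ≤ q → T ∈ trees p q → Valid T (G p q)
trees-sound zero q _ _ (here refl) =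
  lnode (chain Ā q) , refl , trans (chain-contour Ā q) (cong (replicate q Ā ++_) (sym (++-identityʳ _))) ,
  chain-complementary Ā q
trees-sound (suc p) q _ sp≤q (here refl) =
  lnode (closing p j) , refl ,
  trans (closing-contour p j) (cong (G (suc p)) (m∸n+n≡m sp≤q)) ,
  (refl , chain-complementary A p , complementary-++ (chain Ā j) _ (chain-complementary Ā j) (chain-complementary A (suc p)))
  where
    j : ℕ
    j = q ∸ suc p
trees-sound (suc p) q T sp≤q (there T∈) with ∈-map⁻ wrap T∈
... | T′ , T′∈ , refl with trees-sound p q T′ (≤-trans (n≤1+n p) sp≤q) T′∈
... | lnode F , refl , contour≡ , cF = lnode ((A , Ā , lnode F) ∷ []) , refl , wrap-contour p q F contour≡ , (refl , cF , tt)

closing-case : ∀ p q j {ts cs} → q ≡ p + suc j → ComplementaryF ts → ComplementaryF cs →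
  contourF ts ≡ replicate p A ++ replicate p Ā → contourF cs ≡ replicate j Ā ++ replicate q A ++ replicate (suc p) Ā →
  (A , Ā , lnode ts) ∷ cs ≡ closing p (q ∸ suc p)
closing-case p q j {ts} {cs} q≡ cts ccs ts≡ cs≡ =
  cong₂ (λ t c → (A , Ā , lnode t) ∷ c) (chain-unique A p ts cts ts≡)
        (trans (two-chains-unique j (suc p) cs ccs cs-contour) (cong (λ k → chain Ā k ++ chain A (suc p)) (sym j≡)))
  where
    q≡′ : q ≡ j + suc p
    q≡′ = trans q≡ (+-suc-comm p j)
    j≡ : q ∸ suc p ≡ j
    j≡ = trans (cong (_∸ suc p) q≡′) (m+n∸n≡m j (suc p))
    cs-contour : contourF cs ≡ replicate j Ā ++ replicate j A ++ replicate (suc p) A ++ replicate (suc p) Ā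
    cs-contour = trans cs≡ (cong (replicate j Ā ++_)
                   (trans (cong (λ k → replicate k A ++ replicate (suc p) Ā) q≡′)
                          (trans (cong (_++ replicate (suc p) Ā) (replicate-+ j (suc p) A))
                                 (++-assoc (replicate j A) _ _))))

wrapping-case : ∀ p q X {ts cs} → ComplementaryF ts →
  contourF ts ≡ replicate p A ++ replicate q Ā ++ X → X ++ Ā ∷ contourF cs ≡ replicate q A ++ replicate (suc p) Ā →
  cs ≡ [] × contourF ts ≡ G p q
wrapping-case p q X {ts} {cs} cts ts≡ rest
  with split-block {Ā} {A} (λ ()) q (suc p) X _ [] (trans rest (cong (replicate q A ++_) (sym (++-identityʳ _))))
... | inj₂ (X′ , _ , rest′) = ⊥-elim (nonempty X′ Ā _ rest′)
... | inj₁ (i , j , sp≡ , refl , cs≡)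
  with balanced-blocks A p q i (subst Balanced ts≡ (contour-balanced ts cts))
... | refl with no-room p j sp≡
... | refl = contour-empty cs cs≡ , ts≡

trees-complete : ∀ p q F → ComplementaryF F → contourF F ≡ G p q → node (shapeF F) ∈ trees p q
trees-complete zero q F cF eq =
  here (cong (node ∘ shapeF) (chain-unique Ā q F cF (trans eq (cong (replicate q Ā ++_) (++-identityʳ _)))))
trees-complete (suc p) q F cF eq with first-edge {A} {p} {q} F cF eq
... | inside j q≡ cts ccs ts≡ cs≡ = here (cong (node ∘ shapeF) (closing-case p q j q≡ cts ccs ts≡ cs≡))
... | beyond {ts} {cs} X cts _ ts≡ rest with wrapping-case p q X {ts} {cs} cts ts≡ rest
... | refl , ts-contour = there (∈-map⁺ wrap (trees-complete p q ts cts ts-contour))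

-- The trees are distinct: the head of `trees (p+1) q` has at least two
-- root edges, the wrapped trees exactly one, and wrapping is injective.
trees-unique : ∀ p q → Unique (trees p q)
trees-unique zero    q = All.[] ∷ []
trees-unique (suc p) q =
  map⁺ (All.universal (closing-not-wrap (q ∸ suc p)) (trees p q)) ∷ Unique.map⁺ wrap-injective (trees-unique p q)
  where
    closing-not-wrap : ∀ j T → node (shapeF (closing p j)) ≢ wrap T
    closing-not-wrap zero    T ()
    closing-not-wrap (suc j) T ()
    wrap-injective : ∀ {T T′} → wrap T ≡ wrap T′ → T ≡ T′
    wrap-injective refl = refl

trees-length : ∀ p q → length (trees p q) ≡ suc p
trees-length zero    q = refl
trees-length (suc p) q = cong suc (trans (length-map wrap (trees p q)) (trees-length p q))

trees-inhabited : ∀ p q → ∃ λ T → T ∈ trees p q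
trees-inhabited zero    q = _ , here refl
trees-inhabited (suc p) q = _ , here refl

word : ∀ p q → Vec Letter₁ (2 * (p + q))
word p q = cast (G-length p q) (fromList (G p q))

word-toList : ∀ p q → toList (word p q) ≡ G p q
word-toList p q = trans (toList-cast (G-length p q) (fromList (G p q))) (toList∘fromList (G p q))

V-word : ∀ p q → p ≤ q → ∀ T → InV (p + q) (word p q) T ⇔ T ∈ trees p q
V-word p q p≤q T = mk⇔ complete sound
  where
    complete : InV (p + q) (word p q) T → T ∈ trees p q
    complete (_ , lnode F , refl , contour≡ , cF) = trees-complete p q F cF (trans contour≡ (word-toList p q))
    sound : T ∈ trees p q → InV (p + q) (word p q) T
    sound T∈ = *-cancelˡ-≡ (edges T) (p + q) 2 (trans (valid-edges T _ valid) (G-length p q)) ,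
               subst (Valid T) (sym (word-toList p q)) valid
      where
        valid : Valid T (G p q)
        valid = trees-sound p q T p≤q T∈

theorem1p3 : (k : ℕ) → 1 ≤ k → Σ ℕ (λ n → 1 ≤ n × InR₁ n k)
theorem1p3 zero    ()
theorem1p3 (suc p) 1≤k with trees-inhabited p (suc p)
... | T , T∈ =
  p + suc p , ≤-trans 1≤k (m≤n+m (suc p) p) , 1≤k ,
  word p (suc p) , (T , Equivalence.from (V T) T∈) ,
  trees p (suc p) , trees-unique p (suc p) , trees-length p (suc p) , V
  where
    V : ∀ T → InV (p + suc p) (word p (suc p)) T ⇔ T ∈ trees p (suc p)
    V = V-word p (suc p) (n≤1+n p)
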